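{- Let $\mathcal P$ be any (probabilistic or deterministic) exploration protocol for $k$ robots in a ring of $n$ nodes. Then every sequential computation $c$ of $\mathcal P$ that terminates satisfies $|\mathcal{MRP}(c)| \geq n-k+1$.
   Context: Model. A ring has $n$ nodes $u_0,\dots,u_{n-1}$ (indices modulo $n$), $u_i$ adjacent to $u_{i-1}$ and $u_{i+1}$; nodes are anonymous and the ring is unoriented (nothing lets a robot distinguish one direction from the other). There are $k\le n$ robots located on nodes. Robots are anonymous, uniform (all run the same program, with no local parameter such as an identity), oblivious (no memory between cycles) and do not communicate. A protocol is this common program. Each robot repeatedly executes Look–Compute–Move cycles: in Look it observes the number $d_j(t)$ of robots on every node $u_j$ (multiplicity detection), seen from its own node $u_i$ as the unordered pair $\{\gamma^{+i}(t),\gamma^{ -i}(t)\}$ with $\gamma^{+i}(t)=\langle d_i d_{i+1}\dots d_{i+n-1}\rangle$ and $\gamma^{ -i}(t)=\langle d_i d_{i-1}\dots d_{i-(n-1)}\rangle$ (its view); in Compute it decides, deterministically or with randomness, to stay idle or to move to a neighboring node; in Move it moves there. If its view is symmetric ($\gamma^{+i}=\gamma^{ -i}$) and it decides to move, an adversary chooses which of its two incident edges it traverses. Time is a sequence of instants $0,1,2,\dots$; at each instant a nonempty set of robots is activated and each activated robot performs a full cycle atomically between $t$ and $t+1$. The configuration at instant $t$ is $\langle d_0(t)\dots d_{n-1}(t)\rangle$. A tower is a node holding at least two robots; a configuration is towerless if it has no tower. A configuration is terminal if from it the probability that some robot moves is 0. A computation is an infinite sequence of configurations $\gamma_0,\gamma_1,\dots$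 where $\gamma_0$ is a possible initial configuration (initial configurations are towerless) and each $\gamma_{t+1}$ is obtained from $\gamma_t$ after some nonempty set of robots executes a cycle; it terminates if it contains a terminal configuration. The scheduler is distributed and fair: any nonempty subset of robots may be activated at each instant, and every robot is activated infinitely often. A sequential computation is one in which exactly one robot is activated at each instant and every robot is activated infinitely often. A node is visited during a computation if some robot is located on it at some instant. A protocol deterministically (resp. probabilistically) solves the exploration problem, and is then called an exploration protocol, if every computation starting from a towerless configuration terminates in finite time (resp. in finite expected time; non-terminating computations have probability 0) and every node is visited by at least one robot during it. The minimal relevant prefix $\mathcal{MRP}(s)$ of a sequence $s$ of configurations is the maximal subsequence of $s$ in which no two consecutive configurations are identical. -}

module Defs where

open import Data.Nat using (ℕ; zero; suc; _+_; _∸_; _≤_)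
open import Data.Nat.DivMod using (_mod_)
import Data.Nat.Properties as ℕP
open import Data.Fin using (Fin; toℕ)
import Data.Fin.Properties as FinP
open import Data.Vec using (Vec; lookup; tabulate; count)
import Data.Vec.Properties as VecP
open import Data.List using (List; []; _∷_; length; map; upTo)
open import Data.Bool using (Bool; true; false)
open import Data.Product using (Σ; ∃; ∃-syntax; _×_; _,_)
open import Relation.Binary.PropositionalEquality using (_≡_)
open import Relation.Nullary using (yes; no)
open import Function using (_↔_)

sucR : ∀ {n} → Fin n → Fin n
sucR {suc m} i = (suc (toℕ i)) mod (suc m)

-- u_i ↦ u_{i-1}   (i - 1 ≡ i + (n - 1) mod n)
predR : ∀ {n} → Fin n → Fin n
predR {suc m} i = (toℕ i + m) mod (suc m)

iter : ∀ {A : Set} → (A → A) → ℕ → A → A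
iter f zero    x = x
iter f (suc j) x = f (iter f j x)

-- A configuration ⟨d_0 … d_{n-1}⟩ : number of robots on every node.
Config : ℕ → Set
Config n = Vec ℕ n

view⁺ : ∀ {n} → Config n → Fin n → Vec ℕ n
view⁺ γ i = tabulate (λ j → lookup γ (iter sucR (toℕ j) i))

view⁻ : ∀ {n} → Config n → Fin n → Vec ℕ n
view⁻ γ i = tabulate (λ j → lookup γ (iter predR (toℕ j) i))

Towerless : ∀ {n} → Config n → Set
Towerless {n} γ = ∀ (j : Fin n) → lookup γ j ≤ 1

-- The views are given to the protocol as an ordered pair (a , b) (the
-- robot's view is the unordered pair {a , b}); a decision is relative to
-- that ordering: stay idle, move towards the neighbour in the direction
-- whose view is a (towardsFst), or in the direction whose view is b
-- (towardsSnd).  The protocol is given by the support of its (possibly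
-- random, possibly deterministic) decision: 'decides a b m' means that
-- decision m is taken with positive probability.  Invariance under
-- swapping the pair expresses that the view is unordered, and in the
-- symmetric case a = b it makes both directions possible, i.e. the
-- adversary chooses the traversed edge.

data Decision : Set where
  idle towardsFst towardsSnd : Decision

swapD : Decision → Decision
swapD idle       = idle
swapD towardsFst = towardsSnd
swapD towardsSnd = towardsFst

record Protocol (n : ℕ) : Set₁ where
  field
    decides  : Vec ℕ n → Vec ℕ n → Decision → Set
    unorder  : ∀ a b m → decides a b m ↔ decides b a (swapD m)
    nonempty : ∀ a b → ∃[ m ] decides a b m
open Protocol public

-- destination of a robot on u_i after decision m, taken with ordered
-- views (γ^{+i} , γ^{-i})
target : ∀ {n} → Decision → Fin n → Fin n
target idle       i = i
target towardsFst i = sucR i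
target towardsSnd i = predR i

Step : ∀ {n} → Protocol n → Config n → Fin n → Fin n → Set
Step P γ i j = ∃[ m ] (decides P (view⁺ γ i) (view⁻ γ i) m × j ≡ target m i)

Terminal : ∀ {n} → Protocol n → Config n → Set
Terminal {n} P γ = ∀ (i : Fin n) → 1 ≤ lookup γ i →
  ∀ m → decides P (view⁺ γ i) (view⁻ γ i) m → m ≡ idle

-- Computations with k robots (robots are named by Fin k only so that the
-- scheduler can be expressed; the protocol never sees these names).

configOf : ∀ {n k} → (Fin k → Fin n) → Config n
configOf pos = tabulate (λ j → count (λ r → j FinP.≟ r) (tabulate pos))

record Computation {n : ℕ} (k : ℕ) (P : Protocol n) : Set where
  field
    pos       : ℕ → Fin k → Fin n
    active    : ℕ → Fin k → Bool
    initial   : Towerless (configOf (pos 0))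
    nonEmpty  : ∀ t → ∃[ r ] active t r ≡ true
    fair      : ∀ (r : Fin k) t → ∃[ t′ ] (t ≤ t′ × active t′ r ≡ true)
    passive   : ∀ t r → active t r ≡ false → pos (suc t) r ≡ pos t r
    move      : ∀ t r → active t r ≡ true →
                Step P (configOf (pos t)) (pos t r) (pos (suc t) r)

  conf : ℕ → Config n
  conf t = configOf (pos t)
open Computation public

Sequential : ∀ {n k P} → Computation {n} k P → Set
Sequential {k = k} c = ∀ t → ∃[ r ] (active c t r ≡ true ×
                                      (∀ (r′ : Fin k) → active c t r′ ≡ true → r′ ≡ r))

Terminates : ∀ {n k P} → Computation {n} k P → Set
Terminates {P = P} c = ∃[ t ] Terminal P (conf c t)

Visited : ∀ {n k P} → Computation {n} k P → Fin n → Set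
Visited c j = ∃[ t ] 1 ≤ lookup (conf c t) j

IsExplorationProtocol : ∀ {n} → ℕ → Protocol n → Set
IsExplorationProtocol {n} k P =
  ∀ (c : Computation k P) → Terminates c → ∀ (j : Fin n) → Visited c j

collapseFrom : ∀ {n} → Config n → List (Config n) → List (Config n)
collapseFrom x []       = x ∷ []
collapseFrom x (y ∷ xs) with VecP.≡-dec ℕP._≟_ x y
... | yes _ = collapseFrom y xs
... | no  _ = x ∷ collapseFrom y xs

collapse : ∀ {n} → List (Config n) → List (Config n)
collapse []       = []
collapse (x ∷ xs) = collapseFrom x xs

-- |MRP(s)| ≥ m  for an infinite sequence s : some finite prefix already
-- has a minimal relevant prefix of length ≥ m
MRPLength≥ : ∀ {n} → (ℕ → Config n) → ℕ → Set
MRPLength≥ s m = ∃[ T ] (m ≤ length (collapse (map s (upTo (suc T)))))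

-- In a sequential computation the number of nodes visited up to instant T is
-- at most k + m − 1, where m is the length of the minimal relevant prefix of
-- the configurations up to T: initially at most k nodes are occupied and
-- m = 1, and every later step either repeats the configuration (nothing new
-- is visited and m is unchanged) or moves the single active robot (at most
-- one new node, and m grows by one).  A terminating computation of an
-- exploration protocol eventually visits all n nodes, so n ≤ k + m − 1.
module Submission where

open import Defs
open import Data.Nat using (ℕ; _+_; _∸_; _≤_; zero; suc; z≤n; s≤s; _⊔_; _≤′_; ≤′-refl; ≤′-step)
import Data.Nat.Properties as ℕP
open import Data.Fin using (Fin) renaming (zero to fzero; suc to fsuc)
import Data.Fin.Properties as FinP
open import Data.Fin.Subset using (Subset; ⊥; ⊤; ⁅_⁆; _∪_; _∈_; _⊆_; ∣_∣; inside; outside)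
open import Data.Fin.Subset.Properties
  using (∉⊥; ∣⊥∣≡0; ∣⊤∣≡n; x∈⁅x⁆; x∈⁅y⁆⇒x≡y; ∣⁅x⁆∣≡1; p⊆q⇒∣p∣≤∣q∣; p⊆p∪q; q⊆p∪q; x∈p∪q⁺; x∈p∪q⁻)
open import Data.Vec using ([]; _∷_; lookup; tabulate; count)
import Data.Vec.Properties as VecP
open import Data.List using (length; applyUpTo)
import Data.List.Properties as ListP
open import Data.Bool using (true; false)
open import Data.Product using (∃-syntax; _,_; map₂)
open import Data.Sum using (inj₁; inj₂)
open import Function using (_∘_)
open import Relation.Binary.PropositionalEquality
open import Relation.Nullary using (yes; no; contradiction)
open import Relation.Unary using (Pred; Decidable)

∣p∪q∣≤∣p∣+∣q∣ : ∀ {n} (p q : Subset n) → ∣ p ∪ q ∣ ≤ ∣ p ∣ + ∣ q ∣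
∣p∪q∣≤∣p∣+∣q∣ []            []            = z≤n
∣p∪q∣≤∣p∣+∣q∣ (outside ∷ p) (outside ∷ q) = ∣p∪q∣≤∣p∣+∣q∣ p q
∣p∪q∣≤∣p∣+∣q∣ (outside ∷ p) (inside ∷ q)  =
  ℕP.≤-trans (s≤s (∣p∪q∣≤∣p∣+∣q∣ p q)) (ℕP.≤-reflexive (sym (ℕP.+-suc ∣ p ∣ ∣ q ∣)))
∣p∪q∣≤∣p∣+∣q∣ (inside ∷ p)  (outside ∷ q) = s≤s (∣p∪q∣≤∣p∣+∣q∣ p q)
∣p∪q∣≤∣p∣+∣q∣ (inside ∷ p)  (inside ∷ q)  =
  s≤s (ℕP.≤-trans (∣p∪q∣≤∣p∣+∣q∣ p q) (ℕP.+-monoʳ-≤ ∣ p ∣ (ℕP.n≤1+n ∣ q ∣)))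

∪-lub : ∀ {n} {p q r : Subset n} → p ⊆ r → q ⊆ r → p ∪ q ⊆ r
∪-lub {p = p} {q} p⊆r q⊆r x∈ with x∈p∪q⁻ p q x∈
... | inj₁ x∈p = p⊆r x∈p
... | inj₂ x∈q = q⊆r x∈q

image : ∀ {k n} → (Fin k → Fin n) → Subset n
image {zero}  p = ⊥
image {suc k} p = ⁅ p fzero ⁆ ∪ image (p ∘ fsuc)

∈image⁺ : ∀ {k n} (p : Fin k → Fin n) r → p r ∈ image p
∈image⁺ p fzero    = x∈p∪q⁺ (inj₁ (x∈⁅x⁆ (p fzero)))
∈image⁺ p (fsuc r) = x∈p∪q⁺ (inj₂ (∈image⁺ (p ∘ fsuc) r))

∈image⁻ : ∀ {k n} (p : Fin k → Fin n) {x} → x ∈ image p → ∃[ r ] p r ≡ x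
∈image⁻ {zero}  p x∈ = contradiction x∈ ∉⊥
∈image⁻ {suc k} p x∈ with x∈p∪q⁻ ⁅ p fzero ⁆ (image (p ∘ fsuc)) x∈
... | inj₁ x∈⁅p0⁆ = fzero , sym (x∈⁅y⁆⇒x≡y (p fzero) x∈⁅p0⁆)
... | inj₂ x∈img  with ∈image⁻ (p ∘ fsuc) x∈img
...   | r , pr≡x = fsuc r , pr≡x

∣image∣≤ : ∀ {k n} (p : Fin k → Fin n) → ∣ image p ∣ ≤ k
∣image∣≤ {zero}  {n} p = ℕP.≤-reflexive (∣⊥∣≡0 n)
∣image∣≤ {suc k}     p = begin
  ∣ ⁅ p fzero ⁆ ∪ image (p ∘ fsuc) ∣     ≤⟨ ∣p∪q∣≤∣p∣+∣q∣ ⁅ p fzero ⁆ (image (p ∘ fsuc)) ⟩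
  ∣ ⁅ p fzero ⁆ ∣ + ∣ image (p ∘ fsuc) ∣ ≡⟨ cong (_+ ∣ image (p ∘ fsuc) ∣) (∣⁅x⁆∣≡1 (p fzero)) ⟩
  suc ∣ image (p ∘ fsuc) ∣               ≤⟨ s≤s (∣image∣≤ (p ∘ fsuc)) ⟩
  suc k                                  ∎
  where open ℕP.≤-Reasoning

module _ {a ℓ} {A : Set a} {P : Pred A ℓ} (P? : Decidable P) where

  count-tabulate-pos⁻ : ∀ {k} (f : Fin k → A) → 1 ≤ count P? (tabulate f) → ∃[ r ] P (f r)
  count-tabulate-pos⁻ {suc k} f 1≤count with P? (f fzero)
  ... | yes Pf0 = fzero , Pf0
  ... | no  _   with count-tabulate-pos⁻ (f ∘ fsuc) 1≤count
  ...   | r , Pfr = fsuc r , Pfr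

  count-tabulate-pos⁺ : ∀ {k} (f : Fin k → A) r → P (f r) → 1 ≤ count P? (tabulate f)
  count-tabulate-pos⁺ f fzero Pf0 with P? (f fzero)
  ... | yes _   = s≤s z≤n
  ... | no ¬Pf0 = contradiction Pf0 ¬Pf0
  count-tabulate-pos⁺ f (fsuc r) Pfr with P? (f fzero)
  ... | yes _ = s≤s z≤n
  ... | no  _ = count-tabulate-pos⁺ (f ∘ fsuc) r Pfr

occupied⇒∈image : ∀ {k n} (p : Fin k → Fin n) x → 1 ≤ lookup (configOf p) x → x ∈ image p
occupied⇒∈image p x occ
  rewrite VecP.lookup∘tabulate (λ j → count (j FinP.≟_) (tabulate p)) x
  with count-tabulate-pos⁻ (x FinP.≟_) p occ
... | r , x≡pr = subst (_∈ image p) (sym x≡pr) (∈image⁺ p r)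

∈image⇒occupied : ∀ {k n} (p : Fin k → Fin n) x → x ∈ image p → 1 ≤ lookup (configOf p) x
∈image⇒occupied p x x∈
  rewrite VecP.lookup∘tabulate (λ j → count (j FinP.≟_) (tabulate p)) x
  with ∈image⁻ p x∈
... | r , pr≡x = count-tabulate-pos⁺ (x FinP.≟_) p r (sym pr≡x)

image-configOf : ∀ {k n} (p q : Fin k → Fin n) → configOf p ≡ configOf q → image p ⊆ image q
image-configOf p q eq {x} x∈ =
  occupied⇒∈image q x (subst (λ γ → 1 ≤ lookup γ x) eq (∈image⇒occupied p x x∈))

mrpLength : ∀ {n} → (ℕ → Config n) → ℕ → ℕ
mrpLength s T = length (collapse (applyUpTo s (suc T)))

mrpLength-mono : ∀ {n} (s : ℕ → Config n) T → mrpLength s T ≤ mrpLength s (suc T)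
mrpLength-mono s zero with VecP.≡-dec ℕP._≟_ (s 0) (s 1)
... | yes _ = s≤s z≤n
... | no  _ = s≤s z≤n
mrpLength-mono s (suc T) with VecP.≡-dec ℕP._≟_ (s 0) (s 1)
... | yes _ = mrpLength-mono (s ∘ suc) T
... | no  _ = s≤s (mrpLength-mono (s ∘ suc) T)

mrpLength-grows : ∀ {n} (s : ℕ → Config n) T → s (suc T) ≢ s T →
                  mrpLength s T + 1 ≤ mrpLength s (suc T)
mrpLength-grows s zero s1≢s0 with VecP.≡-dec ℕP._≟_ (s 0) (s 1)
... | yes s0≡s1 = contradiction (sym s0≡s1) s1≢s0
... | no  _     = s≤s (s≤s z≤n)
mrpLength-grows s (suc T) s′≢s with VecP.≡-dec ℕP._≟_ (s 0) (s 1)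
... | yes _ = mrpLength-grows (s ∘ suc) T s′≢s
... | no  _ = s≤s (mrpLength-grows (s ∘ suc) T s′≢s)

eventually-∀ : ∀ {ℓ n} (P : ℕ → Fin n → Set ℓ) → (∀ {T T′} j → T ≤ T′ → P T j → P T′ j) →
               (∀ j → ∃[ T ] P T j) → ∃[ T ] ∀ j → P T j
eventually-∀ {n = zero}  P mono ev = 0 , λ ()
eventually-∀ {n = suc n} P mono ev with ev fzero | eventually-∀ (λ T → P T ∘ fsuc) (mono ∘ fsuc) (ev ∘ fsuc)
... | T₀ , P₀ | T₁ , P₁ = T₀ ⊔ T₁ , λ where
  fzero    → mono fzero (ℕP.m≤m⊔n T₀ T₁) P₀
  (fsuc j) → mono (fsuc j) (ℕP.m≤n⊔m T₀ T₁) (P₁ j)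

module _ {n k : ℕ} {P : Protocol n} (c : Computation k P) where

  occupied : ℕ → Subset n
  occupied t = image (pos c t)

  visitedUpTo : ℕ → Subset n
  visitedUpTo zero    = occupied zero
  visitedUpTo (suc T) = visitedUpTo T ∪ occupied (suc T)

  occupied⊆visitedUpTo : ∀ t → occupied t ⊆ visitedUpTo t
  occupied⊆visitedUpTo zero    = λ x∈ → x∈
  occupied⊆visitedUpTo (suc t) = q⊆p∪q (visitedUpTo t) (occupied (suc t))

  visitedUpTo-mono : ∀ {T T′} → T ≤′ T′ → visitedUpTo T ⊆ visitedUpTo T′
  visitedUpTo-mono ≤′-refl          = λ x∈ → x∈
  visitedUpTo-mono (≤′-step T≤′T′) = p⊆p∪q _ ∘ visitedUpTo-mono T≤′T′

  occupied-stutter : ∀ t → conf c (suc t) ≡ conf c t → occupied (suc t) ⊆ occupied t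
  occupied-stutter t = image-configOf (pos c (suc t)) (pos c t)

  occupied-sole-mover : ∀ t r → (∀ r′ → active c t r′ ≡ true → r′ ≡ r) →
                        occupied (suc t) ⊆ occupied t ∪ ⁅ pos c (suc t) r ⁆
  occupied-sole-mover t r sole {x} x∈ with ∈image⁻ (pos c (suc t)) x∈
  ... | r′ , r′-at-x with active c t r′ in act
  ...   | true  = x∈p∪q⁺ (inj₂ (subst (_∈ ⁅ pos c (suc t) r ⁆)
                    (trans (cong (pos c (suc t)) (sym (sole r′ act))) r′-at-x) (x∈⁅x⁆ _)))
  ...   | false = x∈p∪q⁺ (inj₁ (subst (_∈ occupied t)
                    (trans (sym (passive c t r′ act)) r′-at-x) (∈image⁺ (pos c t) r′)))

  visited-bound : Sequential c → ∀ T → ∣ visitedUpTo T ∣ + 1 ≤ k + mrpLength (conf c) T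
  visited-bound seq zero    = ℕP.+-monoˡ-≤ 1 (∣image∣≤ (pos c 0))
  visited-bound seq (suc T) with VecP.≡-dec ℕP._≟_ (conf c (suc T)) (conf c T)
  ... | yes stutter = begin
    ∣ visitedUpTo (suc T) ∣ + 1      ≤⟨ ℕP.+-monoˡ-≤ 1 (p⊆q⇒∣p∣≤∣q∣ visited-same) ⟩
    ∣ visitedUpTo T ∣ + 1            ≤⟨ visited-bound seq T ⟩
    k + mrpLength (conf c) T         ≤⟨ ℕP.+-monoʳ-≤ k (mrpLength-mono (conf c) T) ⟩
    k + mrpLength (conf c) (suc T)   ∎
    where
    open ℕP.≤-Reasoning
    visited-same : visitedUpTo (suc T) ⊆ visitedUpTo T
    visited-same = ∪-lub (λ x∈ → x∈) (occupied⊆visitedUpTo T ∘ occupied-stutter T stutter)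
  ... | no moved with seq T
  ...   | r , _ , sole = begin
    ∣ visitedUpTo (suc T) ∣ + 1          ≤⟨ ℕP.+-monoˡ-≤ 1 (p⊆q⇒∣p∣≤∣q∣ visited-one-more) ⟩
    ∣ visitedUpTo T ∪ ⁅ x ⁆ ∣ + 1        ≤⟨ ℕP.+-monoˡ-≤ 1 (∣p∪q∣≤∣p∣+∣q∣ (visitedUpTo T) ⁅ x ⁆) ⟩
    ∣ visitedUpTo T ∣ + ∣ ⁅ x ⁆ ∣ + 1    ≡⟨ cong (λ m → ∣ visitedUpTo T ∣ + m + 1) (∣⁅x⁆∣≡1 x) ⟩
    ∣ visitedUpTo T ∣ + 1 + 1            ≤⟨ ℕP.+-monoˡ-≤ 1 (visited-bound seq T) ⟩
    k + mrpLength (conf c) T + 1         ≡⟨ ℕP.+-assoc k (mrpLength (conf c) T) 1 ⟩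
    k + (mrpLength (conf c) T + 1)       ≤⟨ ℕP.+-monoʳ-≤ k (mrpLength-grows (conf c) T moved) ⟩
    k + mrpLength (conf c) (suc T)       ∎
    where
    open ℕP.≤-Reasoning
    x : Fin n
    x = pos c (suc T) r
    visited-one-more : visitedUpTo (suc T) ⊆ visitedUpTo T ∪ ⁅ x ⁆
    visited-one-more = ∪-lub (p⊆p∪q ⁅ x ⁆)
      (∪-lub (p⊆p∪q ⁅ x ⁆ ∘ occupied⊆visitedUpTo T) (q⊆p∪q (visitedUpTo T) ⁅ x ⁆)
       ∘ occupied-sole-mover T r sole)

  all-visited : IsExplorationProtocol k P → Terminates c → ∃[ T ] ⊤ ⊆ visitedUpTo T
  all-visited explores terminates =
    map₂ (λ all {x} _ → all x) (eventually-∀ (λ T x → x ∈ visitedUpTo T)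
      (λ x T≤T′ → visitedUpTo-mono (ℕP.≤⇒≤′ T≤T′))
      (λ x → let t , occ = explores c terminates x
             in t , occupied⊆visitedUpTo t (occupied⇒∈image (pos c t) x occ)))

lemma1 : ∀ (n k : ℕ) → k ≤ n → (P : Protocol n) → IsExplorationProtocol k P →
         (c : Computation k P) → Sequential c → Terminates c →
         MRPLength≥ (conf c) (n ∸ k + 1)
lemma1 n k k≤n P explores c seq terminates with all-visited c explores terminates
... | T , ⊤⊆visited = T , subst (λ l → n ∸ k + 1 ≤ length (collapse l))
                              (sym (ListP.map-upTo (conf c) (suc T))) n∸k+1≤mrp
  where
  n≤visited : n ≤ ∣ visitedUpTo c T ∣
  n≤visited = subst (_≤ ∣ visitedUpTo c T ∣) (∣⊤∣≡n n) (p⊆q⇒∣p∣≤∣q∣ ⊤⊆visited)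
  n+1≤k+mrp : n + 1 ≤ k + mrpLength (conf c) T
  n+1≤k+mrp = ℕP.≤-trans (ℕP.+-monoˡ-≤ 1 n≤visited) (visited-bound c seq T)
  n∸k+1≤mrp : n ∸ k + 1 ≤ mrpLength (conf c) T
  n∸k+1≤mrp = subst (_≤ mrpLength (conf c) T) (ℕP.+-∸-comm 1 k≤n) (ℕP.m≤n+o⇒m∸n≤o (n + 1) k n+1≤k+mrp)
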